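{- Let $A=\langle a_1,\ldots,a_m\rangle$ be an $(m,n)$-sequence of integers and $B$ an $(n,m)$-sequence of integers such that the iterated normal trimming $B_A$ exists and $B_A=\mathbf{0}$. If $A'$ is any sequence obtained from $A$ by permuting its entries, then $B_{A'}$ exists and $B_{A'}=\mathbf{0}$.
   Context: An $(m,n)$-sequence is a sequence of $m$ real numbers each in $[0,n]$. For an integer sequence $S$ and an integer $c\ge 0$ at most the number of positive entries of $S$, a normal $c$-trimming $S_{\langle c\rangle}$ is obtained by subtracting $1$ from $c$ largest positive entries of $S$ (for $c=0$, $S_{\langle 0\rangle}=S$). For $A=\langle a_1,\ldots,a_m\rangle$, $B_A$ denotes applying to $B$ a normal $a_1$-trimming, then a normal $a_2$-trimming to the result, and so on up to a normal $a_m$-trimming; $B_A$ exists if each step is possible, i.e. at each step $a_i$ does not exceed the number of positive entries of the current sequence. $\mathbf{0}$ denotes a sequence all of whose entries are zero. -}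

module Defs where

open import Data.Nat using (ℕ; zero; suc; _∸_; _≤_; _<_)
open import Data.Bool using (Bool; true; false; if_then_else_)
open import Data.Fin using (Fin)
open import Data.Vec using (Vec; []; _∷_; lookup; tabulate)
open import Data.List using (List; []; _∷_; length)
open import Data.List.Relation.Unary.All using (All)
open import Data.Product using (Σ; _×_; ∃)
open import Relation.Binary.PropositionalEquality using (_≡_)

count : ∀ {n} → (Fin n → Bool) → ℕ
count {zero} f = 0
count {suc n} f = (if f Fin.zero then 1 else 0) Data.Nat.+ count {n} (λ i → f (Fin.suc i))

-- NormalTrim c S S' : S' is a normal c-trimming of S, i.e. S' is obtained by
-- subtracting 1 from c largest positive entries of S.
NormalTrim : ∀ {n} → ℕ → Vec ℕ n → Vec ℕ n → Set
NormalTrim {n} c S S' =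
  Σ (Fin n → Bool) λ sel →
    (count sel ≡ c)
    × (∀ i → sel i ≡ true → 0 < lookup S i)
    × (∀ i j → sel i ≡ true → sel j ≡ false → 0 < lookup S j → lookup S j ≤ lookup S i)
    × (S' ≡ tabulate (λ i → if sel i then lookup S i ∸ 1 else lookup S i))

-- IterTrim A B C : C is a possible value of B_A (so B_A exists iff some C exists):
-- apply a normal a₁-trimming to B, then a normal a₂-trimming, ..., a normal aₘ-trimming.
data IterTrim {n : ℕ} : List ℕ → Vec ℕ n → Vec ℕ n → Set where
  done : ∀ {B} → IterTrim [] B B
  step : ∀ {a A B B' C} → NormalTrim a B B' → IterTrim A B' C → IterTrim (a ∷ A) B C

IsZero : ∀ {n} → Vec ℕ n → Set
IsZero {n} C = ∀ (i : Fin n) → lookup C i ≡ 0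

{-# OPTIONS --safe #-}
module Submission where

-- Two consecutive normal trimmings can be performed in either order with the same
-- result; as permutations are generated by adjacent transpositions, B_A then depends
-- only on the multiset A.
-- Say B is trimmed at X (|X| = a) and the result at Y (|Y| = b). Entries in X ∩ Y lose
-- 2 either way. Let T consist of the |Y ∖ X| largest entries of B in X △ Y, and trim B
-- first at (X ∩ Y) ∪ T, then at (X ∩ Y) ∪ ((X △ Y) ∖ T): every entry loses the same
-- amount as before, and normality follows from that of X and Y and the choice of T.

open import Defs
open import Data.Nat using (ℕ; _≤_)
open import Data.Vec using (Vec; lookup)
open import Data.Fin using (Fin)
open import Data.List using (List; length)
open import Data.List.Relation.Unary.All using (All)
open import Data.List.Relation.Binary.Permutation.Propositional using (_↭_)
open import Data.Product using (Σ; _×_)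
open import Relation.Binary.PropositionalEquality using (_≡_)

open import Algebra.Properties.CommutativeSemigroup using (interchange)
open import Data.Bool using (Bool; true; false; if_then_else_; _∧_; _∨_; not; _xor_)
open import Data.Bool.Properties using (∨-conicalˡ; ∧-zeroʳ) renaming (_≟_ to _≟ᵇ_)
open import Data.Fin using (zero; suc; _≟_)
open import Data.List using (filter; allFin)
open import Data.List.Extrema.Nat using (argmax; argmax-all; f[xs]≤f[argmax])
open import Data.List.Membership.Propositional.Properties using (∈-filter⁺; ∈-allFin)
import Data.List.Relation.Binary.Permutation.Propositional as ↭
import Data.List.Relation.Unary.All as All
open import Data.List.Relation.Unary.All.Properties using (all-filter)
open import Data.Nat using (zero; suc; _+_; _∸_; _<_; z≤n; s≤s)
open import Data.Nat.Properties
  using (≤-trans; <⇒≤; m≤n+m; m∸n≤m; ∸-monoˡ-≤; +-comm; +-identityʳ; +-cancelˡ-≡; +-cancelʳ-≡;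
         +-cancelʳ-<; +-commutativeSemigroup; module ≤-Reasoning)
open import Data.Product using (_,_; ∃; map₂; proj₁)
open import Data.Sum using (_⊎_; inj₁; inj₂)
open import Data.Vec using (tabulate)
open import Data.Vec.Properties using (lookup∘tabulate; tabulate-cong)
open import Relation.Binary.PropositionalEquality
  using (refl; sym; trans; cong; cong₂; subst; subst₂; module ≡-Reasoning)
open import Relation.Nullary using (does; yes)
open import Relation.Unary using (Decidable)

private
  variable
    n : ℕ

𝟙 : Bool → ℕ
𝟙 b = if b then 1 else 0

_⊆_ : (Fin n → Bool) → (Fin n → Bool) → Set
f ⊆ g = ∀ i → f i ≡ true → g i ≡ true

_∖_ : (Fin n → Bool) → (Fin n → Bool) → Fin n → Bool
(f ∖ g) i = f i ∧ not (g i)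

_△_ : (Fin n → Bool) → (Fin n → Bool) → Fin n → Bool
(f △ g) i = f i xor g i

∖⁺ : ∀ (f g : Fin n → Bool) {i} → f i ≡ true → g i ≡ false → (f ∖ g) i ≡ true
∖⁺ f g fi gi rewrite fi | gi = refl

∖⁻ : ∀ (f g : Fin n → Bool) {i} → (f ∖ g) i ≡ true → f i ≡ true × g i ≡ false
∖⁻ f g {i} f∖g-i with f i | g i
... | true | false = refl , refl

∖-∉ : ∀ (f g : Fin n → Bool) {i} → g i ≡ true → (f ∖ g) i ≡ false
∖-∉ f g {i} gi rewrite gi = ∧-zeroʳ (f i)

△-∖ : ∀ (f g : Fin n → Bool) {i} → (f △ g) i ≡ true → (g ∖ f) i ≡ false → f i ≡ true × g i ≡ false
△-∖ f g {i} f△g-i g∖f-i with f i | g i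
... | true  | false = refl , refl
... | false | true  with g∖f-i
...   | ()

△-∈ˡ : ∀ (f g : Fin n → Bool) {i} → (f △ g) i ≡ true → f i ≡ true → g i ≡ false
△-∈ˡ f g {i} f△g-i fi with f i | g i
... | true | false = refl

count-+-pointwise : (f g h k : Fin n → Bool)
  → (∀ i → 𝟙 (f i) + 𝟙 (g i) ≡ 𝟙 (h i) + 𝟙 (k i))
  → count f + count g ≡ count h + count k
count-+-pointwise {zero} f g h k eq = refl
count-+-pointwise {suc n} f g h k eq = begin
  (𝟙 (f zero) + count (tail f)) + (𝟙 (g zero) + count (tail g))
    ≡⟨ interchange +-commutativeSemigroup (𝟙 (f zero)) _ _ _ ⟩
  (𝟙 (f zero) + 𝟙 (g zero)) + (count (tail f) + count (tail g))
    ≡⟨ cong₂ _+_ (eq zero) (count-+-pointwise (tail f) (tail g) (tail h) (tail k) (λ i → eq (suc i))) ⟩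
  (𝟙 (h zero) + 𝟙 (k zero)) + (count (tail h) + count (tail k))
    ≡⟨ interchange +-commutativeSemigroup (𝟙 (h zero)) _ _ _ ⟩
  (𝟙 (h zero) + count (tail h)) + (𝟙 (k zero) + count (tail k)) ∎
  where
  open ≡-Reasoning
  tail : (Fin (suc n) → Bool) → Fin n → Bool
  tail f i = f (suc i)

count-false : ∀ n → count {n} (λ _ → false) ≡ 0
count-false zero    = refl
count-false (suc n) = count-false n

count-singleton : (m : Fin n) → count (λ i → does (i ≟ m)) ≡ 1
count-singleton {suc n} zero = cong suc (count-false n)
count-singleton (suc m) = count-singleton m

count>0⇒∃ : (f : Fin n → Bool) → 0 < count f → ∃ λ i → f i ≡ true
count>0⇒∃ {suc n} f pos with f zero in f0
... | true = zero , f0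
... | false with count>0⇒∃ (λ i → f (suc i)) pos
...   | i , fi = suc i , fi

∃⇒count>0 : (f : Fin n → Bool) (i : Fin n) → f i ≡ true → 0 < count f
∃⇒count>0 f zero fi rewrite fi = s≤s z≤n
∃⇒count>0 f (suc i) fi = ≤-trans (∃⇒count>0 (λ j → f (suc j)) i fi) (m≤n+m _ (𝟙 (f zero)))

count-∖ : (f g : Fin n → Bool) → g ⊆ f → count (f ∖ g) + count g ≡ count f
count-∖ {n} f g g⊆f = begin
  count (f ∖ g) + count g           ≡⟨ count-+-pointwise (f ∖ g) g f _ (λ i → pointwise (f i) (g i) (g⊆f i)) ⟩
  count f + count {n} (λ _ → false) ≡⟨ cong (count f +_) (count-false n) ⟩
  count f + 0                       ≡⟨ +-identityʳ (count f) ⟩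
  count f                           ∎
  where
  open ≡-Reasoning
  pointwise : ∀ a b → (b ≡ true → a ≡ true) → 𝟙 (a ∧ not b) + 𝟙 b ≡ 𝟙 a + 𝟙 false
  pointwise true  true  _ = refl
  pointwise true  false _ = refl
  pointwise false false _ = refl
  pointwise false true  h with h refl
  ... | ()

count-mono : (f g : Fin n → Bool) → g ⊆ f → count g ≤ count f
count-mono f g g⊆f = subst (count g ≤_) (count-∖ f g g⊆f) (m≤n+m (count g) (count (f ∖ g)))

count-∨-disjoint : (f g : Fin n → Bool) → (∀ i → g i ≡ true → f i ≡ false)
  → count (λ i → f i ∨ g i) ≡ count f + count g
count-∨-disjoint {n} f g disjoint = begin
  count f∨g                           ≡⟨ +-identityʳ _ ⟨
  count f∨g + 0                       ≡⟨ cong (count f∨g +_) (count-false n) ⟨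
  count f∨g + count {n} (λ _ → false) ≡⟨ count-+-pointwise f∨g _ f g (λ i → pointwise (f i) (g i) (disjoint i)) ⟩
  count f + count g                   ∎
  where
  open ≡-Reasoning
  f∨g : Fin n → Bool
  f∨g i = f i ∨ g i
  pointwise : ∀ a b → (b ≡ true → a ≡ false) → 𝟙 (a ∨ b) + 𝟙 false ≡ 𝟙 a + 𝟙 b
  pointwise true  false _ = refl
  pointwise false true  _ = refl
  pointwise false false _ = refl
  pointwise true  true  h with h refl
  ... | ()

equal-count-⊈ : (f g : Fin n → Bool) → count f ≡ count g → ∀ {i} → f i ≡ true → g i ≡ false
  → ∃ λ k → g k ≡ true × f k ≡ false
equal-count-⊈ f g |f|≡|g| {i} fi gi =
  map₂ (∖⁻ g f) (count>0⇒∃ (g ∖ f) (subst (0 <_) (sym |g∖f|≡|f∖g|) f∖g-nonempty))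
  where
  pointwise : ∀ a b → 𝟙 a + 𝟙 (b ∧ not a) ≡ 𝟙 b + 𝟙 (a ∧ not b)
  pointwise true  true  = refl
  pointwise true  false = refl
  pointwise false true  = refl
  pointwise false false = refl
  |g∖f|≡|f∖g| : count (g ∖ f) ≡ count (f ∖ g)
  |g∖f|≡|f∖g| = +-cancelˡ-≡ (count g) _ _
    (trans (cong (_+ count (g ∖ f)) (sym |f|≡|g|)) (count-+-pointwise f (g ∖ f) g (f ∖ g) (λ j → pointwise (f j) (g j))))
  f∖g-nonempty : 0 < count (f ∖ g)
  f∖g-nonempty = ∃⇒count>0 (f ∖ g) i (∖⁺ f g fi gi)

max-selected : (sel : Fin n → Bool) (v : Fin n → ℕ) {i₀ : Fin n} → sel i₀ ≡ true
  → Σ (Fin n) λ m → sel m ≡ true × (∀ j → sel j ≡ true → v j ≤ v m)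
max-selected {n} sel v {i₀} sel-i₀ =
  argmax v i₀ candidates ,
  argmax-all v sel-i₀ (all-filter selected? (allFin n)) ,
  λ j sel-j → All.lookup (f[xs]≤f[argmax] i₀ candidates) (∈-filter⁺ selected? (∈-allFin j) sel-j)
  where
  selected? : Decidable (λ i → sel i ≡ true)
  selected? i = sel i ≟ᵇ true
  candidates : List (Fin n)
  candidates = filter selected? (allFin n)

top-selection : (e : Fin n → Bool) (v : Fin n → ℕ) (k : ℕ) → k ≤ count e
  → Σ (Fin n → Bool) λ T → count T ≡ k × T ⊆ e
      × (∀ i j → T i ≡ true → e j ≡ true → T j ≡ false → v j ≤ v i)
top-selection {n} e v zero _ = (λ _ → false) , count-false n , (λ _ ()) , (λ _ _ ())
top-selection {n} e v (suc k) k<|e| with top-selection e v k (<⇒≤ k<|e|)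
... | T , |T|≡k , T⊆e , T-top with count>0⇒∃ (e ∖ T) e∖T-nonempty
  where
  e∖T-nonempty : 0 < count (e ∖ T)
  e∖T-nonempty = +-cancelʳ-< k 0 (count (e ∖ T))
    (subst (k <_) (trans (sym (count-∖ e T T⊆e)) (cong (count (e ∖ T) +_) |T|≡k)) k<|e|)
... | i₀ , e∖T-i₀ with max-selected (e ∖ T) v e∖T-i₀
... | m , e∖T-m , m-max with ∖⁻ e T e∖T-m
... | e-m , T-m = T′ , |T′|≡1+k , T′⊆e , T′-top
  where
  T′ : Fin n → Bool
  T′ i = T i ∨ does (i ≟ m)

  m∉T : ∀ i → does (i ≟ m) ≡ true → T i ≡ false
  m∉T i _ with i ≟ m
  ... | yes refl = T-m

  ∈T′ : ∀ i → T′ i ≡ true → T i ≡ true ⊎ i ≡ m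
  ∈T′ i _ with T i | i ≟ m
  ... | true  | _       = inj₁ refl
  ... | false | yes i≡m = inj₂ i≡m

  |T′|≡1+k : count T′ ≡ suc k
  |T′|≡1+k = begin
    count T′                             ≡⟨ count-∨-disjoint T (λ i → does (i ≟ m)) m∉T ⟩
    count T + count (λ i → does (i ≟ m)) ≡⟨ cong₂ _+_ |T|≡k (count-singleton m) ⟩
    k + 1                                ≡⟨ +-comm k 1 ⟩
    suc k                                ∎
    where open ≡-Reasoning

  T′⊆e : T′ ⊆ e
  T′⊆e i T′-i with ∈T′ i T′-i
  ... | inj₁ T-i  = T⊆e i T-i
  ... | inj₂ refl = e-m

  T′-top : ∀ i j → T′ i ≡ true → e j ≡ true → T′ j ≡ false → v j ≤ v i
  T′-top i j T′-i e-j T′-j with ∈T′ i T′-i | ∨-conicalˡ (T j) _ T′-j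
  ... | inj₁ T-i  | T-j = T-top i j T-i e-j T-j
  ... | inj₂ refl | T-j = m-max j (∖⁺ e T e-j T-j)

trimIf : Bool → ℕ → ℕ
trimIf b u = if b then u ∸ 1 else u

trim : (Fin n → Bool) → (Fin n → ℕ) → Fin n → ℕ
trim sel v i = trimIf (sel i) (v i)

Positive : (Fin n → Bool) → (Fin n → ℕ) → Set
Positive sel v = ∀ i → sel i ≡ true → 0 < v i

Dominant : (Fin n → Bool) → (Fin n → ℕ) → Set
Dominant sel v = ∀ i j → sel i ≡ true → sel j ≡ false → 0 < v j → v j ≤ v i

NormalSelection : ℕ → (Fin n → Bool) → (Fin n → ℕ) → Set
NormalSelection c sel v = count sel ≡ c × Positive sel v × Dominant sel v

positive-≤⇒≤ : ∀ {m k} → (0 < m → m ≤ k) → m ≤ k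
positive-≤⇒≤ {zero} _ = z≤n
positive-≤⇒≤ {suc m} h = h (s≤s z≤n)

pred-≤-pred⇒≤ : ∀ {m k} → 0 < k → m ∸ 1 ≤ k ∸ 1 → m ≤ k
pred-≤-pred⇒≤ {zero} _ _ = z≤n
pred-≤-pred⇒≤ {suc m} {suc k} _ m≤k = s≤s m≤k

Y′ : Bool → Bool → Bool → Bool
Y′ x y t = (x ∧ y) ∨ t

X′ : Bool → Bool → Bool → Bool
X′ x y t = (x ∧ y) ∨ ((x xor y) ∧ not t)

-- The position of an entry relative to X, Y and T ⊆ X △ Y; "move" means that the
-- entry changes trimming when the order is swapped.
data Role : Bool → Bool → Bool → Set where
  both    : Role true  true  false
  neither : Role false false false
  xStay   : Role true  false false
  xMove   : Role true  false true
  yStay   : Role false true  true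
  yMove   : Role false true  false

role : ∀ x y t → (t ≡ true → (x xor y) ≡ true) → Role x y t
role true  true  false _ = both
role false false false _ = neither
role true  false false _ = xStay
role true  false true  _ = xMove
role false true  true  _ = yStay
role false true  false _ = yMove
role true  true  true  t⇒xor with t⇒xor refl
... | ()
role false false true  t⇒xor with t⇒xor refl
... | ()

module _ {x y t : Bool} where

  Y′-count : Role x y t → 𝟙 (Y′ x y t) + 𝟙 (y ∧ not x) ≡ 𝟙 y + 𝟙 t
  Y′-count both    = refl
  Y′-count neither = refl
  Y′-count xStay   = refl
  Y′-count xMove   = refl
  Y′-count yStay   = refl
  Y′-count yMove   = refl

  X′-Y′-count : Role x y t → 𝟙 (X′ x y t) + 𝟙 (Y′ x y t) ≡ 𝟙 x + 𝟙 y
  X′-Y′-count both    = refl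
  X′-Y′-count neither = refl
  X′-Y′-count xStay   = refl
  X′-Y′-count xMove   = refl
  X′-Y′-count yStay   = refl
  X′-Y′-count yMove   = refl

  trimIf-swap : Role x y t → ∀ u → trimIf y (trimIf x u) ≡ trimIf (X′ x y t) (trimIf (Y′ x y t) u)
  trimIf-swap both    u = refl
  trimIf-swap neither u = refl
  trimIf-swap xStay   u = refl
  trimIf-swap xMove   u = refl
  trimIf-swap yStay   u = refl
  trimIf-swap yMove   u = refl

  module _ {u : ℕ} (x-pos : x ≡ true → 0 < u) (y-pos : y ≡ true → 0 < trimIf x u) where

    Y′-positive : Role x y t → Y′ x y t ≡ true → 0 < u
    Y′-positive both  _ = x-pos refl
    Y′-positive xMove _ = x-pos refl
    Y′-positive yStay _ = y-pos refl

    X′-positive : Role x y t → X′ x y t ≡ true → 0 < trimIf (Y′ x y t) u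
    X′-positive both  _ = y-pos refl
    X′-positive xStay _ = x-pos refl
    X′-positive yMove _ = y-pos refl

module _ {xi yi ti xj yj tj : Bool} {vi vj : ℕ}
  (x-dom : xi ≡ true → xj ≡ false → 0 < vj → vj ≤ vi)
  (y-dom : yi ≡ true → yj ≡ false → 0 < trimIf xj vj → trimIf xj vj ≤ trimIf xi vi)
  where

  Y′-dominant : Role xi yi ti → Role xj yj tj → (xi ≡ true → 0 < vi)
    → (ti ≡ true → (xj xor yj) ≡ true → tj ≡ false → vj ≤ vi)
    → Y′ xi yi ti ≡ true → Y′ xj yj tj ≡ false → 0 < vj → vj ≤ vi
  Y′-dominant both  xStay   x-pos _     _ _ _ = pred-≤-pred⇒≤ (x-pos refl) (positive-≤⇒≤ (y-dom refl refl))
  Y′-dominant both  yMove   _     _     _ _   = x-dom refl refl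
  Y′-dominant both  neither _     _     _ _   = x-dom refl refl
  Y′-dominant xMove xStay   _     T-top _ _ _ = T-top refl refl refl
  Y′-dominant xMove yMove   _     T-top _ _ _ = T-top refl refl refl
  Y′-dominant xMove neither _     _     _ _   = x-dom refl refl
  Y′-dominant yStay xStay   _     T-top _ _ _ = T-top refl refl refl
  Y′-dominant yStay yMove   _     T-top _ _ _ = T-top refl refl refl
  Y′-dominant yStay neither _     _     _ _   = y-dom refl refl

  X′-dominant : Role xi yi ti → Role xj yj tj → (yj ≡ true → 0 < trimIf xj vj)
    → (xi ≡ true → xj ≡ true → tj ≡ true → vj ∸ 1 ≤ vi)
    → (xi ≡ false → yi ≡ true → ti ≡ false → xj ≡ false → vj ∸ 1 ≤ vi)
    → X′ xi yi ti ≡ true → X′ xj yj tj ≡ false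
    → 0 < trimIf (Y′ xj yj tj) vj → trimIf (Y′ xj yj tj) vj ≤ trimIf (Y′ xi yi ti) vi
  X′-dominant both  xMove   _     _    _    _ _ = y-dom refl refl
  X′-dominant both  yStay   y-pos _    _    _ _ = λ _ → ∸-monoˡ-≤ 1 (x-dom refl refl (y-pos refl))
  X′-dominant both  neither _     _    _    _ _ = y-dom refl refl
  X′-dominant xStay xMove   _     ex-x _    _ _ = λ _ → ex-x refl refl refl
  X′-dominant xStay yStay   y-pos _    _    _ _ = λ _ → ≤-trans (m∸n≤m _ 1) (x-dom refl refl (y-pos refl))
  X′-dominant xStay neither _     _    _    _ _ = x-dom refl refl
  X′-dominant yMove xMove   _     _    _    _ _ = y-dom refl refl
  X′-dominant yMove yStay   _     _    ex-y _ _ = λ _ → ex-y refl refl refl refl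
  X′-dominant yMove neither _     _    _    _ _ = y-dom refl refl

module Swapped {a b : ℕ} (v : Fin n → ℕ) (x y : Fin n → Bool)
  (|x|≡a : count x ≡ a) (x-pos : Positive x v) (x-dom : Dominant x v)
  (|y|≡b : count y ≡ b) (y-pos : Positive y (trim x v)) (y-dom : Dominant y (trim x v))
  (T : Fin n → Bool) (|T|≡|y∖x| : count T ≡ count (y ∖ x)) (T⊆x△y : T ⊆ (x △ y))
  (T-top : ∀ i j → T i ≡ true → (x △ y) j ≡ true → T j ≡ false → v j ≤ v i)
  where

  role-at : ∀ i → Role (x i) (y i) (T i)
  role-at i = role (x i) (y i) (T i) (T⊆x△y i)

  y′ x′ : Fin n → Bool
  y′ i = Y′ (x i) (y i) (T i)
  x′ i = X′ (x i) (y i) (T i)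

  y-pos-∖x : ∀ {k} → y k ≡ true → x k ≡ false → 0 < v k
  y-pos-∖x {k} yk xk = subst (λ c → 0 < trimIf c (v k)) xk (y-pos k yk)

  y-dom-across : ∀ {i j} → y i ≡ true → y j ≡ false → x i ≡ false → x j ≡ true → v j ∸ 1 ≤ v i
  y-dom-across {i} {j} yi yj xi xj = positive-≤⇒≤
    (subst₂ (λ c d → 0 < trimIf c (v j) → trimIf c (v j) ≤ trimIf d (v i)) xj xi (y-dom i j yi yj))

  -- Since |T| = |Y ∖ X|, a position leaving one side for the other has a
  -- counterpart k crossing in the opposite direction; the inequality goes through k.
  exchange-x : ∀ i j → x i ≡ true → x j ≡ true → T j ≡ true → v j ∸ 1 ≤ v i
  exchange-x i j xi xj Tj with equal-count-⊈ T (y ∖ x) |T|≡|y∖x| Tj (∖-∉ y x xj)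
  ... | k , y∖x-k , Tk with ∖⁻ y x y∖x-k
  ... | yk , xk = ≤-trans (y-dom-across yk yj xk xj) (x-dom i k xi xk (y-pos-∖x yk xk))
    where
    yj : y j ≡ false
    yj = △-∈ˡ x y (T⊆x△y j Tj) xj

  exchange-y : ∀ i j → x i ≡ false → y i ≡ true → T i ≡ false → x j ≡ false → v j ∸ 1 ≤ v i
  exchange-y i j xi yi Ti xj with equal-count-⊈ (y ∖ x) T (sym |T|≡|y∖x|) (∖⁺ y x yi xi) Ti
  ... | k , Tk , y∖x-k with △-∖ x y (T⊆x△y k Tk) y∖x-k
  ... | xk , yk = begin
    v j ∸ 1  ≤⟨ ∸-monoˡ-≤ 1 (positive-≤⇒≤ (x-dom k j xk xj)) ⟩
    v k ∸ 1  ≤⟨ y-dom-across yi yk xi xk ⟩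
    v i      ∎
    where open ≤-Reasoning

  y′-normal : NormalSelection b y′ v
  y′-normal = |y′|≡b , y′-pos , y′-dom
    where
    |y′|≡b : count y′ ≡ b
    |y′|≡b = +-cancelʳ-≡ (count (y ∖ x)) _ _
      (trans (count-+-pointwise y′ (y ∖ x) y T (λ i → Y′-count (role-at i))) (cong₂ _+_ |y|≡b |T|≡|y∖x|))
    y′-pos : Positive y′ v
    y′-pos i = Y′-positive (x-pos i) (y-pos i) (role-at i)
    y′-dom : Dominant y′ v
    y′-dom i j = Y′-dominant (x-dom i j) (y-dom i j) (role-at i) (role-at j) (x-pos i) (T-top i j)

  x′-normal : NormalSelection a x′ (trim y′ v)
  x′-normal = |x′|≡a , x′-pos , x′-dom
    where
    |x′|≡a : count x′ ≡ a
    |x′|≡a = +-cancelʳ-≡ b _ _ (begin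
      count x′ + b        ≡⟨ cong (count x′ +_) (proj₁ y′-normal) ⟨
      count x′ + count y′ ≡⟨ count-+-pointwise x′ y′ x y (λ i → X′-Y′-count (role-at i)) ⟩
      count x + count y   ≡⟨ cong₂ _+_ |x|≡a |y|≡b ⟩
      a + b               ∎)
      where open ≡-Reasoning
    x′-pos : Positive x′ (trim y′ v)
    x′-pos i = X′-positive (x-pos i) (y-pos i) (role-at i)
    x′-dom : Dominant x′ (trim y′ v)
    x′-dom i j = X′-dominant (x-dom i j) (y-dom i j) (role-at i) (role-at j) (y-pos j) (exchange-x i j) (exchange-y i j)

  trim-swap : ∀ i → trim y (trim x v) i ≡ trim x′ (trim y′ v) i
  trim-swap i = trimIf-swap (role-at i) (v i)

swap-NormalSelection : ∀ {a b} (v : Fin n → ℕ) (x y : Fin n → Bool)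
  → NormalSelection a x v → NormalSelection b y (trim x v)
  → Σ (Fin n → Bool) λ y′ → Σ (Fin n → Bool) λ x′
      → NormalSelection b y′ v × NormalSelection a x′ (trim y′ v)
      × (∀ i → trim y (trim x v) i ≡ trim x′ (trim y′ v) i)
swap-NormalSelection v x y (|x|≡a , x-pos , x-dom) (|y|≡b , y-pos , y-dom)
  with top-selection (x △ y) v (count (y ∖ x)) (count-mono _ (y ∖ x) y∖x⊆x△y)
  where
  y∖x⊆x△y : (y ∖ x) ⊆ (x △ y)
  y∖x⊆x△y i y∖x-i with x i | y i
  ... | false | true = refl
... | T , |T|≡|y∖x| , T⊆x△y , T-top = y′ , x′ , y′-normal , x′-normal , trim-swap
  where open Swapped v x y |x|≡a x-pos x-dom |y|≡b y-pos y-dom T |T|≡|y∖x| T⊆x△y T-top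

NormalSelection-resp : ∀ {c} {sel : Fin n → Bool} {v w : Fin n → ℕ}
  → (∀ i → v i ≡ w i) → NormalSelection c sel v → NormalSelection c sel w
NormalSelection-resp v≗w (|sel|≡c , pos , dom) =
  |sel|≡c ,
  (λ i sel-i → subst (0 <_) (v≗w i) (pos i sel-i)) ,
  (λ i j sel-i sel-j w-j →
    subst₂ _≤_ (v≗w j) (v≗w i) (dom i j sel-i sel-j (subst (0 <_) (sym (v≗w j)) w-j)))

normalTrim : ∀ {c} (sel : Fin n → Bool) {S S′ : Vec ℕ n} → NormalSelection c sel (lookup S)
  → S′ ≡ tabulate (trim sel (lookup S)) → NormalTrim c S S′
normalTrim sel (|sel|≡c , pos , dom) S′≡ = sel , |sel|≡c , pos , dom , S′≡

swap-NormalTrim : ∀ {a b} {B B₁ B₂ : Vec ℕ n} → NormalTrim a B B₁ → NormalTrim b B₁ B₂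
  → Σ (Vec ℕ n) λ B₁′ → NormalTrim b B B₁′ × NormalTrim a B₁′ B₂
swap-NormalTrim {B = B} (x , |x|≡a , x-pos , x-dom , refl) (y , |y|≡b , y-pos , y-dom , refl)
  with swap-NormalSelection (lookup B) x y (|x|≡a , x-pos , x-dom)
         (NormalSelection-resp (lookup∘tabulate _) (|y|≡b , y-pos , y-dom))
... | y′ , x′ , y′-normal , x′-normal , trim-swap =
  B₁′ ,
  normalTrim y′ {S = B} y′-normal refl ,
  normalTrim x′ {S = B₁′} (NormalSelection-resp (λ i → sym (lookup∘tabulate _ i)) x′-normal)
    (tabulate-cong λ i → begin
      trimIf (y i) (lookup (tabulate (trim x (lookup B))) i) ≡⟨ cong (trimIf (y i)) (lookup∘tabulate _ i) ⟩
      trim y (trim x (lookup B)) i                          ≡⟨ trim-swap i ⟩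
      trim x′ (trim y′ (lookup B)) i                        ≡⟨ cong (trimIf (x′ i)) (lookup∘tabulate _ i) ⟨
      trimIf (x′ i) (lookup B₁′ i)                          ∎)
  where
  open ≡-Reasoning
  B₁′ : Vec ℕ _
  B₁′ = tabulate (trim y′ (lookup B))

IterTrim-↭ : ∀ {A A′ : List ℕ} {B C : Vec ℕ n} → A′ ↭ A → IterTrim A B C → IterTrim A′ B C
IterTrim-↭ ↭.refl               trims                      = trims
IterTrim-↭ (↭.prep _ A′↭A)      (step t trims)             = step t (IterTrim-↭ A′↭A trims)
IterTrim-↭ {B = B} (↭.swap _ _ A′↭A) (step t₁ (step t₂ trims)) with swap-NormalTrim {B = B} t₁ t₂
... | _ , t₂′ , t₁′ = step t₂′ (step t₁′ (IterTrim-↭ A′↭A trims))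
IterTrim-↭ (↭.trans A′↭A″ A″↭A) trims                      = IterTrim-↭ A′↭A″ (IterTrim-↭ A″↭A trims)

mainTheorem4 : (m n : ℕ) (A : List ℕ) (B : Vec ℕ n)
    → length A ≡ m
    → All (λ a → a ≤ n) A
    → (∀ (i : Fin n) → lookup B i ≤ m)
    → Σ (Vec ℕ n) (λ C → IterTrim A B C × IsZero C)
    → (A' : List ℕ) → A' ↭ A
    → Σ (Vec ℕ n) (λ C' → IterTrim A' B C' × IsZero C')
mainTheorem4 _ _ _ _ _ _ _ (C , A-trims , C-zero) _ A'↭A = C , IterTrim-↭ A'↭A A-trims , C-zero
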